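{- Let $F_n(x)=F_n(x;y,z,p,q)$ be the polynomial defined below. Then $F_1(x)=x$, and for every $n\ge 1$, $$F_{n+1}(x)=(z-1)z^{n-1}y^n x^{n+1}+p^n x\Bigl((y-1)F_n\Big(\frac{x}{p}\Big)+T_q(F_n(x))\Big|_{x=\frac{x}{p}}\Bigr).$$
   Context: An inversion sequence of length $n$ is a sequence $e=(e_0,\dots,e_{n-1})$ of nonnegative integers with $0\le e_i\le i$ for each $i$; $I_n$ denotes the set of them. For $e\in I_n$: $\mathrm{inv}(e)=|\{(i,j):i<j,\ e_i>e_j\}|$; $\mathrm{sum}(e)=\sum_i e_i$; $\mathrm{noz}(e)=|\{j:e_j=0\}|$; $\mathrm{tel}(e)=n-\mathrm{dist}(e)$ where $\mathrm{dist}(e)$ is the number of distinct entries of $e$; $\mathrm{uel}(e)=n-\max(e)-1$. Define $F_n(x;y,z,p,q)=\sum_{e\in I_n}x^{\mathrm{noz}(e)}y^{\mathrm{tel}(e)}z^{\mathrm{uel}(e)}p^{\mathrm{sum}(e)}q^{\mathrm{inv}(e)}$, written $F_n(x)$. For a polynomial $f(x)$ (coefficients may involve $y,z,p,q$), the $q$-derivative is $D_qf(x)=\frac{f(x)-f(xq)}{x-xq}$, and $T_q=\sum_{k\ge0}\frac{D_q^k}{[k]_q!}$, where $[k]_q=1+q+\dots+q^{k-1}$, $[k]_q!=[k]_q[k-1]_q\cdots[1]_q$, $[0]_q!=1$. The notation $T_q(F_n(x))|_{x=x/p}$ means apply $T_q$ in the variable $x$ and then substitute $x/p$ for $x$. 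-}

module Defs where

open import Level using (_⊔_)
open import Algebra.Bundles using (CommutativeRing)
open import Data.Nat as ℕ using (ℕ; zero; suc; _∸_; _<ᵇ_; _≡ᵇ_; _≤ᵇ_)
open import Data.Bool using (Bool; true; false; if_then_else_)
open import Data.List as List using (List; []; _∷_; [_]; _++_; map; foldr; upTo; concatMap; length)
open import Data.Bool.ListAction using (any)

-- I n : list of all inversion sequences (e_0,…,e_{n-1}) with 0 ≤ e_i ≤ i
I : ℕ → List (List ℕ)
I zero    = [ [] ]
I (suc n) = concatMap (λ e → map (λ v → e ++ [ v ]) (upTo (suc n))) (I n)

count : (ℕ → Bool) → List ℕ → ℕ
count P []       = 0
count P (a ∷ es) = if P a then suc (count P es) else count P es

inv : List ℕ → ℕ
inv []       = 0
inv (a ∷ es) = count (λ b → b <ᵇ a) es ℕ.+ inv es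

sumE : List ℕ → ℕ
sumE = foldr ℕ._+_ 0

noz : List ℕ → ℕ
noz = count (λ b → b ≡ᵇ 0)

dist : List ℕ → ℕ
dist []       = 0
dist (a ∷ es) = if any (λ b → a ≡ᵇ b) es then dist es else suc (dist es)

maxE : List ℕ → ℕ
maxE = foldr ℕ._⊔_ 0

tel : List ℕ → ℕ
tel e = length e ∸ dist e

uel : List ℕ → ℕ
uel e = length e ∸ suc (maxE e)

-- Polynomials in x with coefficients in a commutative ring R
-- (coefficient lists, constant term first)

module _ {c ℓ} (R : CommutativeRing c ℓ) where
  open CommutativeRing R

  Poly : Set c
  Poly = List Carrier

  coeff : Poly → ℕ → Carrier
  coeff []       k       = 0#
  coeff (a ∷ as) zero    = a
  coeff (a ∷ as) (suc k) = coeff as k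

  _≈P_ : Poly → Poly → Set ℓ
  f ≈P g = ∀ k → coeff f k ≈ coeff g k

  pow : Carrier → ℕ → Carrier
  pow a zero    = 1#
  pow a (suc k) = a * pow a k

  sumR : List Carrier → Carrier
  sumR = foldr _+_ 0#

  _⊕_ : Poly → Poly → Poly
  []       ⊕ g        = g
  (a ∷ f)  ⊕ []       = a ∷ f
  (a ∷ f)  ⊕ (b ∷ g)  = (a + b) ∷ (f ⊕ g)

  scale : Carrier → Poly → Poly
  scale a = map (a *_)

  mulX : Poly → Poly
  mulX f = 0# ∷ f

  mono : Carrier → ℕ → Poly
  mono a zero    = [ a ]
  mono a (suc k) = 0# ∷ mono a k

  -- substitution x ↦ x/p, where pinv is an inverse of p:  Σ c_k x^k ↦ Σ c_k pinv^k x^k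
  substDiv : Carrier → Poly → Poly
  substDiv pinv f = map (λ k → coeff f k * pow pinv k) (upTo (length f))

  qbinom : Carrier → ℕ → ℕ → Carrier
  qbinom q m       zero    = 1#
  qbinom q zero    (suc k) = 0#
  qbinom q (suc m) (suc k) = qbinom q m k + pow q (suc k) * qbinom q m (suc k)

  -- q-Taylor operator T_q = Σ_k D_q^k / [k]_q!, given by its action
  -- D_q^k(x^m)/[k]_q! = [m choose k]_q x^(m-k) (k ≤ m), extended linearly:
  -- coefficient of x^j in T_q f is Σ_{m ≥ j} c_m [m choose m-j]_q.
  Tq : Carrier → Poly → Poly
  Tq q f = map (λ j → sumR (map (λ m → if j ≤ᵇ m then coeff f m * qbinom q m (m ∸ j) else 0#)
                                (upTo (length f))))
               (upTo (length f))

  weight : Carrier → Carrier → Carrier → Carrier → List ℕ → Carrier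
  weight y z p q e = pow y (tel e) * (pow z (uel e) * (pow p (sumE e) * pow q (inv e)))

  F : Carrier → Carrier → Carrier → Carrier → ℕ → Poly
  F y z p q n =
    map (λ k → sumR (map (λ e → if noz e ≡ᵇ k then weight y z p q e else 0#) (I n)))
        (upTo (suc n))

  RHS : Carrier → Carrier → Carrier → Carrier → Carrier → ℕ → Poly
  RHS y z p q pinv n =
    mono ((z + - 1#) * (pow z (n ∸ 1) * pow y n)) (suc n)
    ⊕ scale (pow p n) (mulX (scale (y + - 1#) (substDiv pinv (F y z p q n))
                              ⊕ substDiv pinv (Tq q (F y z p q n))))

{-# OPTIONS --safe #-}
-- Every member of I (n+1) is 0 ∷ t with map pred t ∈ I n, and the t above a given e ∈ I n arise by replacing
-- each zero of e by 0 or 1, as recorded by a bit string b, and raising every other entry by one. Along such a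
-- lift, sum(e) grows by n minus the number of zeros of b, inv(e) by the inversions of b, tel(e) by one iff b has
-- no 1, and uel(e) by one iff moreover e is constantly 0. Summing q^inv over the bit strings with a fixed number
-- of ones gives a Gaussian binomial, which is how T_q enters. Writing the extra weight y·z^[e = 0…0] of the
-- all-zero bit string, minus 1, as (y − 1) + y·(z^[e = 0…0] − 1), the first part yields (y − 1) F_n(x/p) and
-- the second survives only for the constant sequence, where it yields (z − 1) z^(n−1) y^n x^(n+1).
module Submission where

open import Defs
open import Algebra.Bundles using (CommutativeRing)
open import Algebra.Properties.CommutativeSemigroup using (x∙yz≈y∙xz)
open import Data.Bool using (Bool; true; false; if_then_else_; not; _∧_; _∨_)
open import Data.Bool.ListAction using (any)
open import Data.Bool.Properties using (∨-zeroʳ)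
open import Data.List using (List; []; _∷_; [_]; _++_; _∷ʳ_; map; length; upTo; applyUpTo; replicate; concatMap)
open import Data.List.Properties using (length-++; length-replicate; length-map; length-upTo; map-∘; map-applyUpTo; map-upTo)
open import Data.List.Relation.Unary.All as All using (All; []; _∷_)
open import Data.List.Relation.Unary.All.Properties using (concat⁺; map⁺; applyUpTo⁺₂; all-upTo)
open import Data.Nat as Nat using (ℕ; zero; suc; pred; _∸_; _⊔_; _≤_; _<_; _≡ᵇ_; _<ᵇ_; _≤ᵇ_; z≤n; s≤s)
import Data.Nat.Properties as ℕₚ
open ℕₚ using (≤ᵇ-reflects-≤; <ᵇ-reflects-<)
open import Data.Nat.Tactic.RingSolver using (solve-∀)
open import Data.Product using (∃-syntax; _×_; _,_)
open import Data.Vec as Vec using (Vec; []; _∷_)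
open import Function using (_∘_; id; _⇔_; mk⇔)
open import Relation.Binary.PropositionalEquality
  using (_≡_; refl; cong; cong₂; sym; trans; subst; subst₂; module ≡-Reasoning)
open import Relation.Nullary using (proof)
open import Relation.Nullary.Decidable using (does-⇔; dec-false)
open import Relation.Nullary.Reflects using (Reflects; ofʸ; ofⁿ)

module _ where
  open Nat using (_+_)
  open ℕₚ using ( m+n∸m≡n; m+n∸n≡m; m∸[m∸n]≡n; m≤m+n; m≤n⇒m≤1+n; +-suc; +-assoc; +-comm; +-∸-assoc
                ; ⊔-assoc; ⊔-identityʳ; +-commutativeSemigroup)

  ≡ᵇ-reflects-≡ : ∀ m n → Reflects (m ≡ n) (m ≡ᵇ n)
  ≡ᵇ-reflects-≡ m n = proof (m Nat.≟ n)

  ≡ᵇ-sym : ∀ m n → (m ≡ᵇ n) ≡ (n ≡ᵇ m)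
  ≡ᵇ-sym m n = does-⇔ (mk⇔ sym sym) (m Nat.≟ n) (n Nat.≟ m)

  bit : Bool → ℕ
  bit false = 0
  bit true  = 1

  zeros : ∀ {m} → Vec Bool m → ℕ
  zeros []          = 0
  zeros (false ∷ b) = suc (zeros b)
  zeros (true  ∷ b) = zeros b

  ones : ∀ {m} → Vec Bool m → ℕ
  ones []          = 0
  ones (false ∷ b) = ones b
  ones (true  ∷ b) = suc (ones b)

  inversions : ∀ {m} → Vec Bool m → ℕ
  inversions []          = 0
  inversions (false ∷ b) = inversions b
  inversions (true  ∷ b) = zeros b + inversions b

  zeros+ones : ∀ {m} (b : Vec Bool m) → zeros b + ones b ≡ m
  zeros+ones []          = refl
  zeros+ones (false ∷ b) = cong suc (zeros+ones b)
  zeros+ones (true  ∷ b) = trans (+-suc (zeros b) (ones b)) (cong suc (zeros+ones b))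

  zeros≤length : ∀ {m} (b : Vec Bool m) → zeros b ≤ m
  zeros≤length b = subst (zeros b ≤_) (zeros+ones b) (m≤m+n (zeros b) (ones b))

  zeros≡⇔ones≡ : ∀ {m j} (b : Vec Bool m) → j ≤ m → zeros b ≡ j ⇔ ones b ≡ m ∸ j
  zeros≡⇔ones≡ {m} {j} b j≤m = mk⇔
    (λ zeros≡j → trans (sym (m+n∸m≡n (zeros b) (ones b))) (cong₂ _∸_ (zeros+ones b) zeros≡j))
    (λ ones≡m∸j → trans (sym (m+n∸n≡m (zeros b) (ones b)))
                        (trans (cong₂ _∸_ (zeros+ones b) ones≡m∸j) (m∸[m∸n]≡n j≤m)))

  zeros-∷ʳ-false : ∀ {m} (b : Vec Bool m) → zeros (b Vec.∷ʳ false) ≡ suc (zeros b)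
  zeros-∷ʳ-false []          = refl
  zeros-∷ʳ-false (false ∷ b) = cong suc (zeros-∷ʳ-false b)
  zeros-∷ʳ-false (true  ∷ b) = zeros-∷ʳ-false b

  zeros-∷ʳ-true : ∀ {m} (b : Vec Bool m) → zeros (b Vec.∷ʳ true) ≡ zeros b
  zeros-∷ʳ-true []          = refl
  zeros-∷ʳ-true (false ∷ b) = cong suc (zeros-∷ʳ-true b)
  zeros-∷ʳ-true (true  ∷ b) = zeros-∷ʳ-true b

  ones-∷ʳ-false : ∀ {m} (b : Vec Bool m) → ones (b Vec.∷ʳ false) ≡ ones b
  ones-∷ʳ-false []          = refl
  ones-∷ʳ-false (false ∷ b) = ones-∷ʳ-false b
  ones-∷ʳ-false (true  ∷ b) = cong suc (ones-∷ʳ-false b)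

  ones-∷ʳ-true : ∀ {m} (b : Vec Bool m) → ones (b Vec.∷ʳ true) ≡ suc (ones b)
  ones-∷ʳ-true []          = refl
  ones-∷ʳ-true (false ∷ b) = ones-∷ʳ-true b
  ones-∷ʳ-true (true  ∷ b) = cong suc (ones-∷ʳ-true b)

  inversions-∷ʳ-false : ∀ {m} (b : Vec Bool m) → inversions (b Vec.∷ʳ false) ≡ ones b + inversions b
  inversions-∷ʳ-false []          = refl
  inversions-∷ʳ-false (false ∷ b) = inversions-∷ʳ-false b
  inversions-∷ʳ-false (true  ∷ b) =
    trans (cong₂ _+_ (zeros-∷ʳ-false b) (inversions-∷ʳ-false b))
          (cong suc (x∙yz≈y∙xz +-commutativeSemigroup (zeros b) (ones b) (inversions b)))

  inversions-∷ʳ-true : ∀ {m} (b : Vec Bool m) → inversions (b Vec.∷ʳ true) ≡ inversions b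
  inversions-∷ʳ-true []          = refl
  inversions-∷ʳ-true (false ∷ b) = inversions-∷ʳ-true b
  inversions-∷ʳ-true (true  ∷ b) = cong₂ _+_ (zeros-∷ʳ-true b) (inversions-∷ʳ-true b)

  zeros-replicate-false : ∀ m → zeros (Vec.replicate m false) ≡ m
  zeros-replicate-false zero    = refl
  zeros-replicate-false (suc m) = cong suc (zeros-replicate-false m)

  inversions-replicate-false : ∀ m → inversions (Vec.replicate m false) ≡ 0
  inversions-replicate-false zero    = refl
  inversions-replicate-false (suc m) = inversions-replicate-false m

  -- Lifting an inversion sequence

  lift : (e : List ℕ) → Vec Bool (noz e) → List ℕ
  lift []          []      = []
  lift (zero ∷ e)  (β ∷ b) = bit β ∷ lift e b
  lift (suc k ∷ e) b       = suc (suc k) ∷ lift e b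

  length-lift : ∀ e b → length (lift e b) ≡ length e
  length-lift []          []      = refl
  length-lift (zero ∷ e)  (β ∷ b) = cong suc (length-lift e b)
  length-lift (suc k ∷ e) b       = cong suc (length-lift e b)

  map-pred-lift : ∀ e b → map pred (lift e b) ≡ e
  map-pred-lift []          []          = refl
  map-pred-lift (zero ∷ e)  (false ∷ b) = cong (0 ∷_) (map-pred-lift e b)
  map-pred-lift (zero ∷ e)  (true  ∷ b) = cong (0 ∷_) (map-pred-lift e b)
  map-pred-lift (suc k ∷ e) b           = cong (suc k ∷_) (map-pred-lift e b)

  noz-lift : ∀ e b → noz (lift e b) ≡ zeros b
  noz-lift []          []          = refl
  noz-lift (zero ∷ e)  (false ∷ b) = cong suc (noz-lift e b)
  noz-lift (zero ∷ e)  (true  ∷ b) = noz-lift e b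
  noz-lift (suc k ∷ e) b           = noz-lift e b

  sumE-lift : ∀ e b → sumE (lift e b) + zeros b ≡ sumE e + length e
  sumE-lift []          []          = refl
  sumE-lift (zero ∷ e)  (false ∷ b) =
    trans (+-suc _ (zeros b)) (trans (cong suc (sumE-lift e b)) (sym (+-suc (sumE e) _)))
  sumE-lift (zero ∷ e)  (true  ∷ b) = trans (cong suc (sumE-lift e b)) (sym (+-suc (sumE e) _))
  sumE-lift (suc k ∷ e) b           = begin
    suc (suc k) + sumE (lift e b) + zeros b   ≡⟨ +-assoc (suc (suc k)) _ (zeros b) ⟩
    suc (suc k) + (sumE (lift e b) + zeros b) ≡⟨ cong (suc (suc k) +_) (sumE-lift e b) ⟩
    suc (suc k) + (sumE e + length e)         ≡⟨ shuffle k (sumE e) (length e) ⟩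
    suc k + sumE e + suc (length e)           ∎
    where
    open ≡-Reasoning
    shuffle : ∀ k s l → suc (suc k) + (s + l) ≡ suc k + s + suc l
    shuffle = solve-∀

  count-<ᵇ0 : ∀ t → count (_<ᵇ 0) t ≡ 0
  count-<ᵇ0 []      = refl
  count-<ᵇ0 (a ∷ t) = count-<ᵇ0 t

  count-<ᵇ1 : ∀ t → count (_<ᵇ 1) t ≡ noz t
  count-<ᵇ1 []          = refl
  count-<ᵇ1 (zero ∷ t)  = cong suc (count-<ᵇ1 t)
  count-<ᵇ1 (suc a ∷ t) = count-<ᵇ1 t

  inv-0∷ : ∀ t → inv (0 ∷ t) ≡ inv t
  inv-0∷ t = cong (_+ inv t) (count-<ᵇ0 t)

  count-lift : ∀ k e b → count (_<ᵇ suc (suc k)) (lift e b) ≡ count (_<ᵇ suc k) e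
  count-lift k []          []          = refl
  count-lift k (zero ∷ e)  (false ∷ b) = cong suc (count-lift k e b)
  count-lift k (zero ∷ e)  (true  ∷ b) = cong suc (count-lift k e b)
  count-lift k (suc j ∷ e) b           = cong (λ c → if j <ᵇ k then suc c else c) (count-lift k e b)

  inv-lift : ∀ e b → inv (lift e b) ≡ inv e + inversions b
  inv-lift []          []          = refl
  inv-lift (zero ∷ e)  (false ∷ b) rewrite count-<ᵇ0 (lift e b) | count-<ᵇ0 e = inv-lift e b
  inv-lift (zero ∷ e)  (true  ∷ b) rewrite count-<ᵇ1 (lift e b) | count-<ᵇ0 e | noz-lift e b | inv-lift e b =
    x∙yz≈y∙xz +-commutativeSemigroup (zeros b) (inv e) (inversions b)
  inv-lift (suc k ∷ e) b rewrite count-lift k e b | inv-lift e b = sym (+-assoc _ (inv e) (inversions b))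

  occurs : ℕ → List ℕ → Bool
  occurs a = any (a ≡ᵇ_)

  occurs-1-lift : ∀ e b → occurs 1 (lift e b) ≡ not (ones b ≡ᵇ 0)
  occurs-1-lift []          []          = refl
  occurs-1-lift (zero ∷ e)  (false ∷ b) = occurs-1-lift e b
  occurs-1-lift (zero ∷ e)  (true  ∷ b) = refl
  occurs-1-lift (suc k ∷ e) b           = occurs-1-lift e b

  liftMax : ℕ → Bool → ℕ
  liftMax zero    raised = bit raised
  liftMax (suc k) _      = suc (suc k)

  1⊔liftMax : ∀ a raised → 1 ⊔ liftMax a raised ≡ liftMax a true
  1⊔liftMax zero    false = refl
  1⊔liftMax zero    true  = refl
  1⊔liftMax (suc a) _     = refl

  2+k⊔liftMax : ∀ k a raised → suc (suc k) ⊔ liftMax a raised ≡ liftMax (suc k ⊔ a) raised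
  2+k⊔liftMax k zero    false = refl
  2+k⊔liftMax k zero    true  = refl
  2+k⊔liftMax k (suc a) _     = refl

  maxE-lift : ∀ e b → maxE (lift e b) ≡ liftMax (maxE e) (not (ones b ≡ᵇ 0))
  maxE-lift []          []          = refl
  maxE-lift (zero ∷ e)  (false ∷ b) = maxE-lift e b
  maxE-lift (zero ∷ e)  (true  ∷ b) = trans (cong (1 ⊔_) (maxE-lift e b)) (1⊔liftMax (maxE e) _)
  maxE-lift (suc k ∷ e) b           = trans (cong (suc (suc k) ⊔_) (maxE-lift e b)) (2+k⊔liftMax k (maxE e) _)

  occurs-0-map-pred : ∀ t → occurs 0 (map pred t) ≡ occurs 0 t ∨ occurs 1 t
  occurs-0-map-pred []                = refl
  occurs-0-map-pred (zero ∷ t)        = refl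
  occurs-0-map-pred (suc zero ∷ t)    = sym (∨-zeroʳ (occurs 0 t))
  occurs-0-map-pred (suc (suc k) ∷ t) = occurs-0-map-pred t

  occurs-suc-map-pred : ∀ k t → occurs (suc k) (map pred t) ≡ occurs (suc (suc k)) t
  occurs-suc-map-pred k []          = refl
  occurs-suc-map-pred k (zero ∷ t)  = occurs-suc-map-pred k t
  occurs-suc-map-pred k (suc a ∷ t) = cong ((suc k ≡ᵇ a) ∨_) (occurs-suc-map-pred k t)

  -- Lowering every entry by one merges the values 0 and 1 and keeps all others apart.
  dist-map-pred : ∀ t → dist t ≡ (if occurs 0 t ∧ occurs 1 t then suc (dist (map pred t)) else dist (map pred t))
  dist-map-pred [] = refl
  dist-map-pred (zero ∷ t) rewrite occurs-0-map-pred t with occurs 0 t | occurs 1 t | dist-map-pred t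
  ... | true  | true  | ih = ih
  ... | true  | false | ih = ih
  ... | false | true  | ih = cong suc ih
  ... | false | false | ih = cong suc ih
  dist-map-pred (suc zero ∷ t) rewrite occurs-0-map-pred t with occurs 0 t | occurs 1 t | dist-map-pred t
  ... | true  | true  | ih = ih
  ... | true  | false | ih = cong suc ih
  ... | false | true  | ih = ih
  ... | false | false | ih = cong suc ih
  dist-map-pred (suc (suc k) ∷ t) rewrite occurs-suc-map-pred k t
    with occurs (suc (suc k)) t | occurs 0 t ∧ occurs 1 t | dist-map-pred t
  ... | true  | _     | ih = ih
  ... | false | true  | ih = cong suc ih
  ... | false | false | ih = cong suc ih

  dist≤length : ∀ t → dist t ≤ length t
  dist≤length []      = z≤n
  dist≤length (a ∷ t) with occurs a t
  ... | true  = m≤n⇒m≤1+n (dist≤length t)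
  ... | false = s≤s (dist≤length t)

  tel-lift : ∀ e b → tel (0 ∷ lift (0 ∷ e) b) ≡ (if ones b ≡ᵇ 0 then suc (tel (0 ∷ e)) else tel (0 ∷ e))
  tel-lift e b
    rewrite dist-map-pred (0 ∷ lift (0 ∷ e) b) | map-pred-lift (0 ∷ e) b
          | occurs-1-lift (0 ∷ e) b | length-lift (0 ∷ e) b
    with ones b ≡ᵇ 0
  ... | true  = +-∸-assoc 1 (dist≤length (0 ∷ e))
  ... | false = refl

  uel-lift : ∀ e b →
    uel (0 ∷ lift (0 ∷ e) b) ≡ (if (maxE e ≡ᵇ 0) ∧ (ones b ≡ᵇ 0) then suc (uel (0 ∷ e)) else uel (0 ∷ e))
  uel-lift e b rewrite length-lift (0 ∷ e) b | maxE-lift (0 ∷ e) b with ones b ≡ᵇ 0 | maxE e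
  ... | true  | zero  = refl
  ... | false | zero  = refl
  ... | _     | suc k = refl

  noz≤length : ∀ t → noz t ≤ length t
  noz≤length []          = z≤n
  noz≤length (zero ∷ t)  = s≤s (noz≤length t)
  noz≤length (suc a ∷ t) = m≤n⇒m≤1+n (noz≤length t)

  length-∷ʳ : ∀ (t : List ℕ) v → length (t ∷ʳ v) ≡ suc (length t)
  length-∷ʳ t v = trans (length-++ t) (+-comm (length t) 1)

  All-I-suc : ∀ {P Q : List ℕ → Set} n → (∀ {e} v → P e → Q (e ∷ʳ v)) → All P (I n) → All Q (I (suc n))
  All-I-suc n step = concat⁺ ∘ map⁺ ∘ All.map (λ Pe → map⁺ (applyUpTo⁺₂ id (suc n) (λ v → step v Pe)))

  I-length : ∀ n → All (λ e → length e ≡ n) (I n)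
  I-length zero    = refl ∷ []
  I-length (suc n) = All-I-suc n (λ {e} v len → trans (length-∷ʳ e v) (cong suc len)) (I-length n)

  I-suc-shape : ∀ n → All (λ e → ∃[ t ] e ≡ 0 ∷ t × length t ≡ n) (I (suc n))
  I-suc-shape zero    = ([] , refl , refl) ∷ []
  I-suc-shape (suc n) =
    All-I-suc (suc n) (λ { v (t , refl , len) → t ∷ʳ v , refl , trans (length-∷ʳ t v) (cong suc len) }) (I-suc-shape n)

  maxE-∷ʳ : ∀ t v → maxE (t ∷ʳ v) ≡ maxE t ⊔ v
  maxE-∷ʳ []      v = ⊔-identityʳ v
  maxE-∷ʳ (a ∷ t) v = trans (cong (a ⊔_) (maxE-∷ʳ t v)) (sym (⊔-assoc a (maxE t) v))

  ⊔≡ᵇ0 : ∀ a v → (a ⊔ v ≡ᵇ 0) ≡ (a ≡ᵇ 0) ∧ (v ≡ᵇ 0)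
  ⊔≡ᵇ0 zero    v       = refl
  ⊔≡ᵇ0 (suc a) zero    = refl
  ⊔≡ᵇ0 (suc a) (suc v) = refl

  maxE-∷ʳ≡ᵇ0 : ∀ t v → (maxE (t ∷ʳ v) ≡ᵇ 0) ≡ (maxE t ≡ᵇ 0) ∧ (v ≡ᵇ 0)
  maxE-∷ʳ≡ᵇ0 t v = trans (cong (_≡ᵇ 0) (maxE-∷ʳ t v)) (⊔≡ᵇ0 (maxE t) v)

  maxE≡0⇒replicate : ∀ t → maxE t ≡ 0 → t ≡ replicate (length t) 0
  maxE≡0⇒replicate []          _  = refl
  maxE≡0⇒replicate (zero ∷ t)  eq = cong (0 ∷_) (maxE≡0⇒replicate t eq)
  maxE≡0⇒replicate (suc a ∷ t) eq with maxE t | eq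
  ... | zero  | ()
  ... | suc _ | ()

  noz-replicate-0 : ∀ n → noz (replicate n 0) ≡ n
  noz-replicate-0 zero    = refl
  noz-replicate-0 (suc n) = cong suc (noz-replicate-0 n)

  sumE-replicate-0 : ∀ n → sumE (replicate n 0) ≡ 0
  sumE-replicate-0 zero    = refl
  sumE-replicate-0 (suc n) = sumE-replicate-0 n

  inv-replicate-0 : ∀ n → inv (replicate n 0) ≡ 0
  inv-replicate-0 zero    = refl
  inv-replicate-0 (suc n) rewrite count-<ᵇ0 (replicate n 0) = inv-replicate-0 n

  maxE-replicate-0 : ∀ n → maxE (replicate n 0) ≡ 0
  maxE-replicate-0 zero    = refl
  maxE-replicate-0 (suc n) = maxE-replicate-0 n

  dist-replicate-0 : ∀ n → dist (replicate (suc n) 0) ≡ 1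
  dist-replicate-0 zero    = refl
  dist-replicate-0 (suc n) = dist-replicate-0 n

  tel-replicate-0 : ∀ n → tel (replicate (suc n) 0) ≡ n
  tel-replicate-0 n rewrite dist-replicate-0 n = length-replicate n

  uel-replicate-0 : ∀ n → uel (replicate (suc n) 0) ≡ n
  uel-replicate-0 n rewrite maxE-replicate-0 n = length-replicate n

module _ {c ℓ} (R : CommutativeRing c ℓ) where
  open CommutativeRing R renaming (refl to ≈-refl; sym to ≈-sym; trans to ≈-trans) hiding (zero)
  open import Relation.Binary.Reasoning.Setoid setoid
  open import Algebra.Properties.CommutativeSemigroup +-commutativeSemigroup using ()
    renaming (interchange to +-interchange)
  open import Algebra.Properties.CommutativeSemigroup *-commutativeSemigroup using ()
    renaming (interchange to *-interchange)
  open import Algebra.Solver.Ring.NaturalCoefficients.Default commutativeSemiring using (solve; _:+_; _:*_; _:=_; con)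

  private variable A B : Set

  infixr 8 _^_
  _^_ : Carrier → ℕ → Carrier
  _^_ = pow R

  ^-+ : ∀ a i k → a ^ (i Nat.+ k) ≈ a ^ i * a ^ k
  ^-+ a zero    k = ≈-sym (*-identityˡ _)
  ^-+ a (suc i) k = ≈-trans (*-congˡ (^-+ a i k)) (≈-sym (*-assoc a _ _))

  if-false : ∀ {β} {x : Carrier} → β ≡ false → (if β then x else 0#) ≈ 0#
  if-false refl = ≈-refl

  if-≈0 : ∀ (β : Bool) {x} → x ≈ 0# → (if β then x else 0#) ≈ 0#
  if-≈0 true  x≈0 = x≈0
  if-≈0 false _   = ≈-refl

  if-cong : ∀ (β : Bool) {x x′ : Carrier} → x ≈ x′ → (if β then x else 0#) ≈ (if β then x′ else 0#)
  if-cong true  x≈x′ = x≈x′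
  if-cong false _    = ≈-refl

  if-*ʳ : ∀ (β : Bool) a x → (if β then a else 0#) * x ≈ (if β then a * x else 0#)
  if-*ʳ true  a x = ≈-refl
  if-*ʳ false a x = zeroˡ x

  if-<ᵇ-elim : ∀ k L {x : Carrier} → (L ≤ k → x ≈ 0#) → (if k <ᵇ L then x else 0#) ≈ x
  if-<ᵇ-elim k L x≈0 with k <ᵇ L | <ᵇ-reflects-< k L
  ... | true  | _        = ≈-refl
  ... | false | ofⁿ k≮L = ≈-sym (x≈0 (ℕₚ.≮⇒≥ k≮L))

  1+[x-1] : ∀ x → 1# + (x + - 1#) ≈ x
  1+[x-1] x = begin
    1# + (x + - 1#) ≈⟨ solve 3 (λ x o m → o :+ (x :+ m) := x :+ (o :+ m)) ≈-refl x 1# (- 1#) ⟩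
    x + (1# + - 1#) ≈⟨ +-congˡ (-‿inverseʳ 1#) ⟩
    x + 0#          ≈⟨ +-identityʳ x ⟩
    x               ∎

  xy-1 : ∀ x y → x * y + - 1# ≈ (x + - 1#) + x * (y + - 1#)
  xy-1 x y = ≈-sym (begin
    (x + - 1#) + x * (y + - 1#)      ≈⟨ +-congʳ (+-congʳ (*-identityʳ x)) ⟨
    (x * 1# + - 1#) + x * (y + - 1#) ≈⟨ solve 4 (λ x y m o → (x :* o :+ m) :+ x :* (y :+ m) := (x :* y :+ m) :+ x :* (o :+ m))
                                                ≈-refl x y (- 1#) 1# ⟩
    (x * y + - 1#) + x * (1# + - 1#) ≈⟨ +-congˡ (≈-trans (*-congˡ (-‿inverseʳ 1#)) (zeroʳ x)) ⟩
    (x * y + - 1#) + 0#              ≈⟨ +-identityʳ _ ⟩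
    x * y + - 1#                     ∎)

  ∑ : List A → (A → Carrier) → Carrier
  ∑ l f = sumR R (map f l)

  ∑-cong : ∀ (l : List A) {f g : A → Carrier} → (∀ a → f a ≈ g a) → ∑ l f ≈ ∑ l g
  ∑-cong []      f≈g = ≈-refl
  ∑-cong (a ∷ l) f≈g = +-cong (f≈g a) (∑-cong l f≈g)

  ∑-congᴬ : ∀ {P : A → Set} {l} {f g : A → Carrier} → All P l → (∀ {a} → P a → f a ≈ g a) → ∑ l f ≈ ∑ l g
  ∑-congᴬ []         f≈g = ≈-refl
  ∑-congᴬ (pa ∷ pl) f≈g = +-cong (f≈g pa) (∑-congᴬ pl f≈g)

  ∑-zero : ∀ (l : List A) → ∑ l (λ _ → 0#) ≈ 0#
  ∑-zero []      = ≈-refl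
  ∑-zero (a ∷ l) = ≈-trans (+-identityˡ _) (∑-zero l)

  ∑-++ : ∀ (xs ys : List A) (f : A → Carrier) → ∑ (xs ++ ys) f ≈ ∑ xs f + ∑ ys f
  ∑-++ []       ys f = ≈-sym (+-identityˡ _)
  ∑-++ (x ∷ xs) ys f = ≈-trans (+-congˡ (∑-++ xs ys f)) (≈-sym (+-assoc _ _ _))

  ∑-+ : ∀ (l : List A) (f g : A → Carrier) → ∑ l (λ a → f a + g a) ≈ ∑ l f + ∑ l g
  ∑-+ []      f g = ≈-sym (+-identityˡ 0#)
  ∑-+ (a ∷ l) f g = ≈-trans (+-congˡ (∑-+ l f g)) (+-interchange _ _ _ _)

  *-distribˡ-∑ : ∀ (l : List A) x (f : A → Carrier) → x * ∑ l f ≈ ∑ l (λ a → x * f a)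
  *-distribˡ-∑ []      x f = zeroʳ x
  *-distribˡ-∑ (a ∷ l) x f = ≈-trans (distribˡ x _ _) (+-congˡ (*-distribˡ-∑ l x f))

  *-distribʳ-∑ : ∀ (l : List A) x (f : A → Carrier) → ∑ l f * x ≈ ∑ l (λ a → f a * x)
  *-distribʳ-∑ []      x f = zeroˡ x
  *-distribʳ-∑ (a ∷ l) x f = ≈-trans (distribʳ x _ _) (+-congˡ (*-distribʳ-∑ l x f))

  ∑-comm : ∀ (l : List A) (m : List B) (h : A → B → Carrier) →
    ∑ l (λ a → ∑ m (h a)) ≈ ∑ m (λ b → ∑ l (λ a → h a b))
  ∑-comm []      m h = ≈-sym (∑-zero m)
  ∑-comm (a ∷ l) m h = ≈-trans (+-congˡ (∑-comm l m h)) (≈-sym (∑-+ m (h a) (λ b → ∑ l (λ a′ → h a′ b))))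

  ∑-map : ∀ (g : A → B) l (f : B → Carrier) → ∑ (map g l) f ≡ ∑ l (f ∘ g)
  ∑-map g l f = cong (sumR R) (sym (map-∘ l))

  ∑-concatMap : ∀ (g : A → List B) l (f : B → Carrier) → ∑ (concatMap g l) f ≈ ∑ l (λ a → ∑ (g a) f)
  ∑-concatMap g []      f = ≈-refl
  ∑-concatMap g (a ∷ l) f = ≈-trans (∑-++ (g a) (concatMap g l) f) (+-congˡ (∑-concatMap g l f))

  ∑-upTo-suc : ∀ n (f : ℕ → Carrier) → ∑ (upTo (suc n)) f ≡ f 0 + ∑ (upTo n) (f ∘ suc)
  ∑-upTo-suc n f = cong (λ l → f 0 + sumR R l) (trans (map-applyUpTo suc f n) (sym (map-upTo (f ∘ suc) n)))

  ∑-upTo-δ : ∀ {a L} (h : ℕ → Carrier) → a < L → ∑ (upTo L) (λ m → if a ≡ᵇ m then h m else 0#) ≈ h a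
  ∑-upTo-δ {zero}  {suc L} h _ = begin
    ∑ (upTo (suc L)) (λ m → if 0 ≡ᵇ m then h m else 0#)
      ≡⟨ ∑-upTo-suc L (λ m → if 0 ≡ᵇ m then h m else 0#) ⟩
    h 0 + ∑ (upTo L) (λ _ → 0#)
      ≈⟨ +-congˡ (∑-zero (upTo L)) ⟩
    h 0 + 0#
      ≈⟨ +-identityʳ (h 0) ⟩
    h 0 ∎
  ∑-upTo-δ {suc a} {suc L} h (s≤s a<L) = begin
    ∑ (upTo (suc L)) (λ m → if suc a ≡ᵇ m then h m else 0#)
      ≡⟨ ∑-upTo-suc L (λ m → if suc a ≡ᵇ m then h m else 0#) ⟩
    0# + ∑ (upTo L) (λ m → if a ≡ᵇ m then h (suc m) else 0#)
      ≈⟨ +-identityˡ _ ⟩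
    ∑ (upTo L) (λ m → if a ≡ᵇ m then h (suc m) else 0#)
      ≈⟨ ∑-upTo-δ (h ∘ suc) a<L ⟩
    h (suc a) ∎

  bitStrings : ∀ m → List (Vec Bool m)
  bitStrings zero    = [ [] ]
  bitStrings (suc m) = map (false ∷_) (bitStrings m) ++ map (true ∷_) (bitStrings m)

  ∑-bitStrings-suc : ∀ m (h : Vec Bool (suc m) → Carrier) →
    ∑ (bitStrings (suc m)) h ≈ ∑ (bitStrings m) (h ∘ (false ∷_)) + ∑ (bitStrings m) (h ∘ (true ∷_))
  ∑-bitStrings-suc m h = begin
    ∑ (bitStrings (suc m)) h
      ≈⟨ ∑-++ (map (false ∷_) (bitStrings m)) (map (true ∷_) (bitStrings m)) h ⟩
    ∑ (map (false ∷_) (bitStrings m)) h + ∑ (map (true ∷_) (bitStrings m)) h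
      ≡⟨ cong₂ _+_ (∑-map (false ∷_) (bitStrings m) h) (∑-map (true ∷_) (bitStrings m) h) ⟩
    ∑ (bitStrings m) (h ∘ (false ∷_)) + ∑ (bitStrings m) (h ∘ (true ∷_)) ∎

  ∑-bitStrings-∷ʳ : ∀ m (h : Vec Bool (suc m) → Carrier) →
    ∑ (bitStrings (suc m)) h
      ≈ ∑ (bitStrings m) (λ b → h (b Vec.∷ʳ false)) + ∑ (bitStrings m) (λ b → h (b Vec.∷ʳ true))
  ∑-bitStrings-∷ʳ zero    h = ∑-bitStrings-suc zero h
  ∑-bitStrings-∷ʳ (suc m) h = begin
    ∑ (bitStrings (suc (suc m))) h
      ≈⟨ ∑-bitStrings-suc (suc m) h ⟩
    ∑ (bitStrings (suc m)) (h ∘ (false ∷_)) + ∑ (bitStrings (suc m)) (h ∘ (true ∷_))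
      ≈⟨ +-cong (∑-bitStrings-∷ʳ m (h ∘ (false ∷_))) (∑-bitStrings-∷ʳ m (h ∘ (true ∷_))) ⟩
    (∑ (bitStrings m) (λ b → h (false ∷ (b Vec.∷ʳ false))) + ∑ (bitStrings m) (λ b → h (false ∷ (b Vec.∷ʳ true))))
      + (∑ (bitStrings m) (λ b → h (true ∷ (b Vec.∷ʳ false))) + ∑ (bitStrings m) (λ b → h (true ∷ (b Vec.∷ʳ true))))
      ≈⟨ +-interchange _ _ _ _ ⟩
    (∑ (bitStrings m) (λ b → h (false ∷ (b Vec.∷ʳ false))) + ∑ (bitStrings m) (λ b → h (true ∷ (b Vec.∷ʳ false))))
      + (∑ (bitStrings m) (λ b → h (false ∷ (b Vec.∷ʳ true))) + ∑ (bitStrings m) (λ b → h (true ∷ (b Vec.∷ʳ true))))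
      ≈⟨ +-cong (∑-bitStrings-suc m (λ b → h (b Vec.∷ʳ false))) (∑-bitStrings-suc m (λ b → h (b Vec.∷ʳ true))) ⟨
    ∑ (bitStrings (suc m)) (λ b → h (b Vec.∷ʳ false)) + ∑ (bitStrings (suc m)) (λ b → h (b Vec.∷ʳ true)) ∎

  ∑-bitStrings-noOnes : ∀ m (h : Vec Bool m → Carrier) →
    ∑ (bitStrings m) (λ b → if ones b ≡ᵇ 0 then h b else 0#) ≈ h (Vec.replicate m false)
  ∑-bitStrings-noOnes zero    h = +-identityʳ (h [])
  ∑-bitStrings-noOnes (suc m) h = begin
    ∑ (bitStrings (suc m)) (λ b → if ones b ≡ᵇ 0 then h b else 0#)
      ≈⟨ ∑-bitStrings-suc m (λ b → if ones b ≡ᵇ 0 then h b else 0#) ⟩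
    ∑ (bitStrings m) (λ b → if ones b ≡ᵇ 0 then h (false ∷ b) else 0#) + ∑ (bitStrings m) (λ _ → 0#)
      ≈⟨ +-cong (∑-bitStrings-noOnes m (h ∘ (false ∷_))) (∑-zero (bitStrings m)) ⟩
    h (Vec.replicate (suc m) false) + 0#
      ≈⟨ +-identityʳ _ ⟩
    h (Vec.replicate (suc m) false) ∎

  ∑-bitStrings-ones : ∀ q m k → ∑ (bitStrings m) (λ b → if ones b ≡ᵇ k then q ^ inversions b else 0#) ≈ qbinom R q m k
  ∑-bitStrings-ones q zero    zero    = +-identityʳ 1#
  ∑-bitStrings-ones q zero    (suc k) = +-identityʳ 0#
  ∑-bitStrings-ones q (suc m) k = begin
    ∑ (bitStrings (suc m)) (byOnes k)
      ≈⟨ ∑-bitStrings-∷ʳ m (byOnes k) ⟩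
    ∑ (bitStrings m) (λ b → byOnes k (b Vec.∷ʳ false)) + ∑ (bitStrings m) (λ b → byOnes k (b Vec.∷ʳ true))
      ≈⟨ +-cong appendFalse (∑-cong (bitStrings m) (λ b → reflexive (appendTrue b))) ⟩
    q ^ k * qbinom R q m k + ∑ (bitStrings m) (λ b → if suc (ones b) ≡ᵇ k then q ^ inversions b else 0#)
      ≈⟨ pascal k ⟩
    qbinom R q (suc m) k ∎
    where
    byOnes : ∀ {m} → ℕ → Vec Bool m → Carrier
    byOnes k b = if ones b ≡ᵇ k then q ^ inversions b else 0#

    appendTrue : ∀ b → byOnes k (b Vec.∷ʳ true) ≡ (if suc (ones b) ≡ᵇ k then q ^ inversions b else 0#)
    appendTrue b rewrite ones-∷ʳ-true b | inversions-∷ʳ-true b = refl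

    byOnes-∷ʳ-false : ∀ b → byOnes k (b Vec.∷ʳ false) ≈ q ^ k * byOnes k b
    byOnes-∷ʳ-false b rewrite ones-∷ʳ-false b | inversions-∷ʳ-false b with ones b ≡ᵇ k | ≡ᵇ-reflects-≡ (ones b) k
    ... | true  | ofʸ ones≡k = ≈-trans (^-+ q (ones b) (inversions b)) (*-congʳ (reflexive (cong (q ^_) ones≡k)))
    ... | false | ofⁿ _      = ≈-sym (zeroʳ _)

    appendFalse : ∑ (bitStrings m) (λ b → byOnes k (b Vec.∷ʳ false)) ≈ q ^ k * qbinom R q m k
    appendFalse = begin
      ∑ (bitStrings m) (λ b → byOnes k (b Vec.∷ʳ false)) ≈⟨ ∑-cong (bitStrings m) byOnes-∷ʳ-false ⟩
      ∑ (bitStrings m) (λ b → q ^ k * byOnes k b)        ≈⟨ *-distribˡ-∑ (bitStrings m) (q ^ k) (byOnes k) ⟨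
      q ^ k * ∑ (bitStrings m) (byOnes k)                ≈⟨ *-congˡ (∑-bitStrings-ones q m k) ⟩
      q ^ k * qbinom R q m k                             ∎

    pascal : ∀ k → q ^ k * qbinom R q m k + ∑ (bitStrings m) (λ b → if suc (ones b) ≡ᵇ k then q ^ inversions b else 0#)
                   ≈ qbinom R q (suc m) k
    pascal zero    = ≈-trans (+-cong (*-identityˡ 1#) (∑-zero (bitStrings m))) (+-identityʳ 1#)
    pascal (suc k) = ≈-trans (+-congˡ (∑-bitStrings-ones q m k)) (+-comm _ _)

  ∑-bitStrings-zeros : ∀ q m j →
    ∑ (bitStrings m) (λ b → if zeros b ≡ᵇ j then q ^ inversions b else 0#)
      ≈ (if j ≤ᵇ m then qbinom R q m (m ∸ j) else 0#)
  ∑-bitStrings-zeros q m j with j ≤ᵇ m | ≤ᵇ-reflects-≤ j m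
  ... | true  | ofʸ j≤m = ≈-trans (∑-cong (bitStrings m) (λ b → reflexive (cong (λ β → if β then q ^ inversions b else 0#)
                                    (does-⇔ (zeros≡⇔ones≡ b j≤m) (zeros b Nat.≟ j) (ones b Nat.≟ (m ∸ j))))))
                                  (∑-bitStrings-ones q m (m ∸ j))
  ... | false | ofⁿ j≰m = ≈-trans (∑-cong (bitStrings m) (λ b → if-false (dec-false (zeros b Nat.≟ j)
                                    (λ zeros≡j → j≰m (subst (_≤ m) zeros≡j (zeros≤length b))))))
                                  (∑-zero (bitStrings m))

  ∑-lifts : List ℕ → (List ℕ → Carrier) → Carrier
  ∑-lifts e g = ∑ (bitStrings (noz e)) (g ∘ lift e)

  ∑-lifts-++ : ∀ e e′ (g : List ℕ → Carrier) →
    ∑-lifts (e ++ e′) g ≈ ∑-lifts e (λ t → ∑-lifts e′ (λ s → g (t ++ s)))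
  ∑-lifts-++ []          e′ g = ≈-sym (+-identityʳ _)
  ∑-lifts-++ (zero ∷ e)  e′ g = begin
    ∑-lifts (0 ∷ e ++ e′) g
      ≈⟨ ∑-bitStrings-suc (noz (e ++ e′)) (g ∘ lift (0 ∷ e ++ e′)) ⟩
    ∑-lifts (e ++ e′) (g ∘ (0 ∷_)) + ∑-lifts (e ++ e′) (g ∘ (1 ∷_))
      ≈⟨ +-cong (∑-lifts-++ e e′ (g ∘ (0 ∷_))) (∑-lifts-++ e e′ (g ∘ (1 ∷_))) ⟩
    ∑-lifts e (λ t → ∑-lifts e′ (λ s → g (0 ∷ t ++ s))) + ∑-lifts e (λ t → ∑-lifts e′ (λ s → g (1 ∷ t ++ s)))
      ≈⟨ ≈-sym (∑-bitStrings-suc (noz e) (λ b → ∑-lifts e′ (λ s → g (lift (0 ∷ e) b ++ s)))) ⟩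
    ∑-lifts (0 ∷ e) (λ t → ∑-lifts e′ (λ s → g (t ++ s))) ∎
  ∑-lifts-++ (suc k ∷ e) e′ g = ∑-lifts-++ e e′ (g ∘ (suc (suc k) ∷_))

  ∑-upTo-lifts-singleton : ∀ n (h : List ℕ → Carrier) →
    ∑ (upTo (suc n)) (λ u → ∑-lifts [ u ] h) ≈ ∑ (upTo (suc (suc n))) (λ v → h [ v ])
  ∑-upTo-lifts-singleton n h = begin
    ∑ (upTo (suc n)) (λ u → ∑-lifts [ u ] h)
      ≡⟨ ∑-upTo-suc n (λ u → ∑-lifts [ u ] h) ⟩
    (h [ 0 ] + (h [ 1 ] + 0#)) + ∑ (upTo n) (λ u → h [ suc (suc u) ] + 0#)
      ≈⟨ +-cong (+-congˡ (+-identityʳ _)) (∑-cong (upTo n) (λ u → +-identityʳ _)) ⟩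
    (h [ 0 ] + h [ 1 ]) + ∑ (upTo n) (λ u → h [ suc (suc u) ])
      ≈⟨ +-assoc _ _ _ ⟩
    h [ 0 ] + (h [ 1 ] + ∑ (upTo n) (λ u → h [ suc (suc u) ]))
      ≡⟨ sym (trans (∑-upTo-suc (suc n) (λ v → h [ v ])) (cong (h [ 0 ] +_) (∑-upTo-suc n (λ v → h [ suc v ])))) ⟩
    ∑ (upTo (suc (suc n))) (λ v → h [ v ]) ∎

  ∑-I-suc : ∀ n (f : List ℕ → Carrier) → ∑ (I (suc n)) f ≈ ∑ (I n) (λ e → ∑ (upTo (suc n)) (λ v → f (e ∷ʳ v)))
  ∑-I-suc n f = ≈-trans (∑-concatMap (λ e → map (e ∷ʳ_) (upTo (suc n))) (I n) f)
                        (∑-cong (I n) (λ e → reflexive (∑-map (e ∷ʳ_) (upTo (suc n)) f)))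

  ∑-I-lifts : ∀ n (f : List ℕ → Carrier) → ∑ (I (suc n)) f ≈ ∑ (I n) (λ e → ∑-lifts e (f ∘ (0 ∷_)))
  ∑-I-lifts zero    f = +-congʳ (≈-sym (+-identityʳ _))
  ∑-I-lifts (suc n) f = begin
    ∑ (I (suc (suc n))) f
      ≈⟨ ∑-I-suc (suc n) f ⟩
    ∑ (I (suc n)) (λ e → ∑ (upTo (suc (suc n))) (λ v → f (e ∷ʳ v)))
      ≈⟨ ∑-I-lifts n (λ e → ∑ (upTo (suc (suc n))) (λ v → f (e ∷ʳ v))) ⟩
    ∑ (I n) (λ e → ∑-lifts e (λ t → ∑ (upTo (suc (suc n))) (λ v → f (0 ∷ t ∷ʳ v))))
      ≈⟨ ∑-cong (I n) (λ e → ∑-cong (bitStrings (noz e)) (λ b →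
           ≈-sym (∑-upTo-lifts-singleton n (λ s → f (0 ∷ lift e b ++ s))))) ⟩
    ∑ (I n) (λ e → ∑-lifts e (λ t → ∑ (upTo (suc n)) (λ u → ∑-lifts [ u ] (λ s → f (0 ∷ t ++ s)))))
      ≈⟨ ∑-cong (I n) (λ e → ∑-comm (bitStrings (noz e)) (upTo (suc n)) _) ⟩
    ∑ (I n) (λ e → ∑ (upTo (suc n)) (λ u → ∑-lifts e (λ t → ∑-lifts [ u ] (λ s → f (0 ∷ t ++ s)))))
      ≈⟨ ∑-cong (I n) (λ e → ∑-cong (upTo (suc n)) (λ u → ≈-sym (∑-lifts-++ e [ u ] (f ∘ (0 ∷_))))) ⟩
    ∑ (I n) (λ e → ∑ (upTo (suc n)) (λ u → ∑-lifts (e ∷ʳ u) (f ∘ (0 ∷_))))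
      ≈⟨ ≈-sym (∑-I-suc n (λ e → ∑-lifts e (f ∘ (0 ∷_)))) ⟩
    ∑ (I (suc n)) (λ e → ∑-lifts e (f ∘ (0 ∷_))) ∎

  ∑-upTo-at-0 : ∀ n (β : Bool) (X : Carrier) →
    ∑ (upTo (suc n)) (λ v → if β ∧ (v ≡ᵇ 0) then X else 0#) ≈ (if β then X else 0#)
  ∑-upTo-at-0 n false X = ∑-zero (upTo (suc n))
  ∑-upTo-at-0 n true  X = begin
    ∑ (upTo (suc n)) (λ v → if v ≡ᵇ 0 then X else 0#) ≡⟨ ∑-upTo-suc n (λ v → if v ≡ᵇ 0 then X else 0#) ⟩
    X + ∑ (upTo n) (λ _ → 0#)                         ≈⟨ +-congˡ (∑-zero (upTo n)) ⟩
    X + 0#                                            ≈⟨ +-identityʳ X ⟩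
    X                                                 ∎

  -- The constant zero sequence is the only member of I n with maximum 0.
  ∑-I-maxE≡0 : ∀ n (X : Carrier) → ∑ (I n) (λ e → if maxE e ≡ᵇ 0 then X else 0#) ≈ X
  ∑-I-maxE≡0 zero    X = +-identityʳ X
  ∑-I-maxE≡0 (suc n) X = begin
    ∑ (I (suc n)) (λ e → if maxE e ≡ᵇ 0 then X else 0#)
      ≈⟨ ∑-I-suc n (λ e → if maxE e ≡ᵇ 0 then X else 0#) ⟩
    ∑ (I n) (λ e → ∑ (upTo (suc n)) (λ v → if maxE (e ∷ʳ v) ≡ᵇ 0 then X else 0#))
      ≈⟨ ∑-cong (I n) (λ e → ∑-cong (upTo (suc n)) (λ v →
           reflexive (cong (λ β → if β then X else 0#) (maxE-∷ʳ≡ᵇ0 e v)))) ⟩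
    ∑ (I n) (λ e → ∑ (upTo (suc n)) (λ v → if (maxE e ≡ᵇ 0) ∧ (v ≡ᵇ 0) then X else 0#))
      ≈⟨ ∑-cong (I n) (λ e → ∑-upTo-at-0 n (maxE e ≡ᵇ 0) X) ⟩
    ∑ (I n) (λ e → if maxE e ≡ᵇ 0 then X else 0#)
      ≈⟨ ∑-I-maxE≡0 n X ⟩
    X ∎

  coeff-map-applyUpTo : ∀ (g : ℕ → Carrier) h L k → coeff R (map g (applyUpTo h L)) k ≡ (if k <ᵇ L then g (h k) else 0#)
  coeff-map-applyUpTo g h zero    k       = refl
  coeff-map-applyUpTo g h (suc L) zero    = refl
  coeff-map-applyUpTo g h (suc L) (suc k) = coeff-map-applyUpTo g (h ∘ suc) L k

  coeff-beyond : ∀ f k → length f ≤ k → coeff R f k ≡ 0#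
  coeff-beyond []      k       _         = refl
  coeff-beyond (a ∷ f) (suc k) (s≤s f≤k) = coeff-beyond f k f≤k

  coeff-⊕ : ∀ f g k → coeff R (_⊕_ R f g) k ≈ coeff R f k + coeff R g k
  coeff-⊕ []      g       k       = ≈-sym (+-identityˡ _)
  coeff-⊕ (a ∷ f) []      k       = ≈-sym (+-identityʳ _)
  coeff-⊕ (a ∷ f) (b ∷ g) zero    = ≈-refl
  coeff-⊕ (a ∷ f) (b ∷ g) (suc k) = coeff-⊕ f g k

  coeff-scale : ∀ a f k → coeff R (scale R a f) k ≈ a * coeff R f k
  coeff-scale a []      k       = ≈-sym (zeroʳ a)
  coeff-scale a (b ∷ f) zero    = ≈-refl
  coeff-scale a (b ∷ f) (suc k) = coeff-scale a f k

  coeff-mono : ∀ a d k → coeff R (mono R a d) k ≡ (if k ≡ᵇ d then a else 0#)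
  coeff-mono a zero    zero    = refl
  coeff-mono a zero    (suc k) = refl
  coeff-mono a (suc d) zero    = refl
  coeff-mono a (suc d) (suc k) = coeff-mono a d k

  coeff-substDiv : ∀ p⁻¹ f k → coeff R (substDiv R p⁻¹ f) k ≈ coeff R f k * p⁻¹ ^ k
  coeff-substDiv p⁻¹ f k = ≈-trans (reflexive (coeff-map-applyUpTo (λ i → coeff R f i * p⁻¹ ^ i) id (length f) k))
    (if-<ᵇ-elim k (length f) (λ f≤k → ≈-trans (*-congʳ (reflexive (coeff-beyond f k f≤k))) (zeroˡ _)))

  coeff-Tq : ∀ q f j →
    coeff R (Tq R q f) j ≈ ∑ (upTo (length f)) (λ m → if j ≤ᵇ m then coeff R f m * qbinom R q m (m ∸ j) else 0#)
  coeff-Tq q f j = ≈-trans (reflexive (coeff-map-applyUpTo _ id (length f) j))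
    (if-<ᵇ-elim j (length f) (λ f≤j → ≈-trans
      (∑-congᴬ (all-upTo (length f)) (λ m<f → if-false (dec-false (j Nat.≤? _) (ℕₚ.<⇒≱ (ℕₚ.<-≤-trans m<f f≤j)))))
      (∑-zero (upTo (length f)))))

  coeff-F : ∀ y z p q n k → coeff R (F R y z p q n) k ≈ ∑ (I n) (λ e → if noz e ≡ᵇ k then weight R y z p q e else 0#)
  coeff-F y z p q n k = ≈-trans (reflexive (coeff-map-applyUpTo _ id (suc n) k))
    (if-<ᵇ-elim k (suc n) (λ n<k → ≈-trans
      (∑-congᴬ (I-length n) (λ {e} len → if-false (dec-false (noz e Nat.≟ k)
         (λ noz≡k → ℕₚ.<⇒≱ n<k (subst₂ _≤_ noz≡k len (noz≤length e))))))
      (∑-zero (I n))))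

  -- The recurrence

  module Recurrence (y z p q p⁻¹ : Carrier) (p*p⁻¹≈1 : p * p⁻¹ ≈ 1#) where

    w : List ℕ → Carrier
    w = weight R y z p q

    ^-inverse : ∀ k → p ^ k * p⁻¹ ^ k ≈ 1#
    ^-inverse zero    = *-identityˡ 1#
    ^-inverse (suc k) = begin
      (p * p ^ k) * (p⁻¹ * p⁻¹ ^ k) ≈⟨ *-interchange p (p ^ k) p⁻¹ (p⁻¹ ^ k) ⟩
      (p * p⁻¹) * (p ^ k * p⁻¹ ^ k) ≈⟨ *-cong p*p⁻¹≈1 (^-inverse k) ⟩
      1# * 1#                       ≈⟨ *-identityˡ 1# ⟩
      1#                            ∎

    ^-if-suc : ∀ a (β : Bool) k → a ^ (if β then suc k else k) ≈ (if β then a else 1#) * a ^ k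
    ^-if-suc a true  k = ≈-refl
    ^-if-suc a false k = ≈-sym (*-identityˡ _)

    zFactor : Bool → Carrier
    zFactor allZero = if allZero then z else 1#

    -- The factor y^Δtel · z^Δuel by which a lift of 0 ∷ t changes the weight.
    noOneFactor : Bool → Bool → Carrier
    noOneFactor noOne allZero = if noOne then y * zFactor allZero else 1#

    noOneFactor-split : ∀ noOne allZero →
      (if noOne then y else 1#) * (if allZero ∧ noOne then z else 1#) ≈ noOneFactor noOne allZero
    noOneFactor-split true  true  = ≈-refl
    noOneFactor-split true  false = ≈-refl
    noOneFactor-split false true  = *-identityˡ 1#
    noOneFactor-split false false = *-identityˡ 1#

    weight-lift*p^zeros : ∀ t b →
      w (0 ∷ lift (0 ∷ t) b) * p ^ zeros b
        ≈ (p ^ suc (length t) * w (0 ∷ t)) * (noOneFactor (ones b ≡ᵇ 0) (maxE t ≡ᵇ 0) * q ^ inversions b)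
    weight-lift*p^zeros t b = begin
      w (0 ∷ s) * p ^ zeros b
        ≈⟨ *-congʳ (*-cong tel-part (*-cong uel-part (*-congˡ inv-part))) ⟩
      ((fy * Y) * ((fz * Z) * (p ^ sumE s * (Qt * Qb)))) * p ^ zeros b
        ≈⟨ solve 8 (λ fy Y fz Z Ps Qt Qb Pz → ((fy :* Y) :* ((fz :* Z) :* (Ps :* (Qt :* Qb)))) :* Pz
                                        := (Y :* (Z :* ((Ps :* Pz) :* Qt))) :* ((fy :* fz) :* Qb))
                 ≈-refl fy Y fz Z (p ^ sumE s) Qt Qb (p ^ zeros b) ⟩
      (Y * (Z * ((p ^ sumE s * p ^ zeros b) * Qt))) * ((fy * fz) * Qb)
        ≈⟨ *-cong (*-congˡ (*-congˡ (*-congʳ sum-part))) (*-congʳ (noOneFactor-split (ones b ≡ᵇ 0) (maxE t ≡ᵇ 0))) ⟩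
      (Y * (Z * ((p ^ sumE t * p ^ suc (length t)) * Qt))) * (noOneFactor (ones b ≡ᵇ 0) (maxE t ≡ᵇ 0) * Qb)
        ≈⟨ *-congʳ (solve 5 (λ Y Z Ps Pn Qt → Y :* (Z :* ((Ps :* Pn) :* Qt)) := Pn :* (Y :* (Z :* (Ps :* Qt))))
                          ≈-refl Y Z (p ^ sumE t) (p ^ suc (length t)) Qt) ⟩
      (p ^ suc (length t) * w (0 ∷ t)) * (noOneFactor (ones b ≡ᵇ 0) (maxE t ≡ᵇ 0) * Qb) ∎
      where
      s  = lift (0 ∷ t) b
      fy = if ones b ≡ᵇ 0 then y else 1#
      fz = if (maxE t ≡ᵇ 0) ∧ (ones b ≡ᵇ 0) then z else 1#
      Y  = y ^ tel (0 ∷ t)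
      Z  = z ^ uel (0 ∷ t)
      Qt = q ^ inv (0 ∷ t)
      Qb = q ^ inversions b

      tel-part : y ^ tel (0 ∷ s) ≈ fy * Y
      tel-part = ≈-trans (reflexive (cong (y ^_) (tel-lift t b))) (^-if-suc y (ones b ≡ᵇ 0) (tel (0 ∷ t)))

      uel-part : z ^ uel (0 ∷ s) ≈ fz * Z
      uel-part = ≈-trans (reflexive (cong (z ^_) (uel-lift t b))) (^-if-suc z ((maxE t ≡ᵇ 0) ∧ (ones b ≡ᵇ 0)) (uel (0 ∷ t)))

      inv-part : q ^ inv (0 ∷ s) ≈ Qt * Qb
      inv-part = ≈-trans (reflexive (cong (q ^_) (trans (inv-0∷ s) (inv-lift (0 ∷ t) b)))) (^-+ q (inv (0 ∷ t)) (inversions b))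

      sum-part : p ^ sumE s * p ^ zeros b ≈ p ^ sumE t * p ^ suc (length t)
      sum-part = ≈-trans (≈-sym (^-+ p (sumE s) (zeros b)))
                         (≈-trans (reflexive (cong (p ^_) (sumE-lift (0 ∷ t) b))) (^-+ p (sumE t) (suc (length t))))

    weight-lift : ∀ t b →
      w (0 ∷ lift (0 ∷ t) b)
        ≈ (p ^ suc (length t) * w (0 ∷ t) * p⁻¹ ^ zeros b) * (noOneFactor (ones b ≡ᵇ 0) (maxE t ≡ᵇ 0) * q ^ inversions b)
    weight-lift t b = begin
      W′                                   ≈⟨ *-identityʳ W′ ⟨
      W′ * 1#                              ≈⟨ *-congˡ (^-inverse (zeros b)) ⟨
      W′ * (p ^ zeros b * p⁻¹ ^ zeros b)   ≈⟨ *-assoc W′ _ _ ⟨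
      (W′ * p ^ zeros b) * p⁻¹ ^ zeros b   ≈⟨ *-congʳ (weight-lift*p^zeros t b) ⟩
      (K * Fb) * p⁻¹ ^ zeros b             ≈⟨ *-assoc K Fb _ ⟩
      K * (Fb * p⁻¹ ^ zeros b)             ≈⟨ *-congˡ (*-comm Fb _) ⟩
      K * (p⁻¹ ^ zeros b * Fb)             ≈⟨ *-assoc K _ Fb ⟨
      (K * p⁻¹ ^ zeros b) * Fb             ∎
      where
      W′ = w (0 ∷ lift (0 ∷ t) b)
      K  = p ^ suc (length t) * w (0 ∷ t)
      Fb = noOneFactor (ones b ≡ᵇ 0) (maxE t ≡ᵇ 0) * q ^ inversions b

    lift-term-split : ∀ t j b →
      let K = p ^ suc (length t) * w (0 ∷ t) * p⁻¹ ^ j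
          D = y * zFactor (maxE t ≡ᵇ 0) + - 1# in
      (if noz (lift (0 ∷ t) b) ≡ᵇ j then w (0 ∷ lift (0 ∷ t) b) else 0#)
        ≈ K * (if zeros b ≡ᵇ j then q ^ inversions b else 0#)
          + K * (if ones b ≡ᵇ 0 then (if zeros b ≡ᵇ j then D * q ^ inversions b else 0#) else 0#)
    lift-term-split t j b rewrite noz-lift (0 ∷ t) b with zeros b ≡ᵇ j | ≡ᵇ-reflects-≡ (zeros b) j
    ... | true  | ofʸ refl = ≈-trans (weight-lift t b) (split (ones b ≡ᵇ 0))
      where
      K = p ^ suc (length t) * w (0 ∷ t) * p⁻¹ ^ zeros b
      D = y * zFactor (maxE t ≡ᵇ 0) + - 1#
      Q = q ^ inversions b
      split : ∀ noOne → K * (noOneFactor noOne (maxE t ≡ᵇ 0) * Q) ≈ K * Q + K * (if noOne then D * Q else 0#)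
      split true  = begin
        K * ((y * zFactor (maxE t ≡ᵇ 0)) * Q) ≈⟨ *-congˡ (*-congʳ (1+[x-1] _)) ⟨
        K * ((1# + D) * Q)                     ≈⟨ *-congˡ (≈-trans (distribʳ Q 1# D) (+-congʳ (*-identityˡ Q))) ⟩
        K * (Q + D * Q)                        ≈⟨ distribˡ K Q (D * Q) ⟩
        K * Q + K * (D * Q)                    ∎
      split false = ≈-trans (*-congˡ (*-identityˡ Q)) (≈-sym (≈-trans (+-congˡ (zeroʳ K)) (+-identityʳ _)))
    ... | false | ofⁿ _    =
      ≈-sym (≈-trans (+-cong (zeroʳ _) (≈-trans (*-congˡ (if-≈0 (ones b ≡ᵇ 0) ≈-refl)) (zeroʳ _))) (+-identityʳ 0#))

    ∑-lifts-coeff : ∀ t j →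
      let m = noz (0 ∷ t) in
      ∑-lifts (0 ∷ t) (λ s → if noz s ≡ᵇ j then w (0 ∷ s) else 0#)
        ≈ (p ^ suc (length t) * w (0 ∷ t) * p⁻¹ ^ j)
          * ((if j ≤ᵇ m then qbinom R q m (m ∸ j) else 0#)
             + (if m ≡ᵇ j then (y * zFactor (maxE t ≡ᵇ 0) + - 1#) * 1# else 0#))
    ∑-lifts-coeff t j = begin
      ∑ bs (λ b → if noz (lift (0 ∷ t) b) ≡ᵇ j then w (0 ∷ lift (0 ∷ t) b) else 0#)
        ≈⟨ ∑-cong bs (lift-term-split t j) ⟩
      ∑ bs (λ b → K * byZeros b + K * (if ones b ≡ᵇ 0 then h b else 0#))
        ≈⟨ ∑-+ bs (λ b → K * byZeros b) (λ b → K * (if ones b ≡ᵇ 0 then h b else 0#)) ⟩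
      ∑ bs (λ b → K * byZeros b) + ∑ bs (λ b → K * (if ones b ≡ᵇ 0 then h b else 0#))
        ≈⟨ +-cong (*-distribˡ-∑ bs K byZeros) (*-distribˡ-∑ bs K (λ b → if ones b ≡ᵇ 0 then h b else 0#)) ⟨
      K * ∑ bs byZeros + K * ∑ bs (λ b → if ones b ≡ᵇ 0 then h b else 0#)
        ≈⟨ +-cong (*-congˡ (∑-bitStrings-zeros q m j)) (*-congˡ (∑-bitStrings-noOnes m h)) ⟩
      K * (if j ≤ᵇ m then qbinom R q m (m ∸ j) else 0#) + K * h (Vec.replicate m false)
        ≡⟨ cong (λ x → K * (if j ≤ᵇ m then qbinom R q m (m ∸ j) else 0#) + K * x) h-allFalse ⟩
      K * (if j ≤ᵇ m then qbinom R q m (m ∸ j) else 0#) + K * (if m ≡ᵇ j then D * 1# else 0#)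
        ≈⟨ distribˡ K _ _ ⟨
      K * ((if j ≤ᵇ m then qbinom R q m (m ∸ j) else 0#) + (if m ≡ᵇ j then D * 1# else 0#)) ∎
      where
      m  = noz (0 ∷ t)
      bs = bitStrings m
      K  = p ^ suc (length t) * w (0 ∷ t) * p⁻¹ ^ j
      D  = y * zFactor (maxE t ≡ᵇ 0) + - 1#
      byZeros : Vec Bool m → Carrier
      byZeros b = if zeros b ≡ᵇ j then q ^ inversions b else 0#
      h : Vec Bool m → Carrier
      h b = if zeros b ≡ᵇ j then D * q ^ inversions b else 0#
      h-allFalse : h (Vec.replicate m false) ≡ (if m ≡ᵇ j then D * 1# else 0#)
      h-allFalse rewrite zeros-replicate-false m | inversions-replicate-false m = refl

    regroup : ∀ (β₁ β₂ : Bool) Pn W Pj Qb u v →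
      (Pn * W * Pj) * ((if β₁ then Qb else 0#) + (if β₂ then u + v else 0#))
        ≈ (Pn * Pj) * (u * (if β₂ then W else 0#) + (if β₁ then W * Qb else 0#)) + (Pn * Pj) * (if β₂ then W * v else 0#)
    regroup true  true  = solve 6 (λ Pn W Pj Qb u v → (Pn :* W :* Pj) :* (Qb :+ (u :+ v))
                                   := (Pn :* Pj) :* (u :* W :+ W :* Qb) :+ (Pn :* Pj) :* (W :* v)) ≈-refl
    regroup true  false = solve 6 (λ Pn W Pj Qb u v → (Pn :* W :* Pj) :* (Qb :+ con 0)
                                   := (Pn :* Pj) :* (u :* con 0 :+ W :* Qb) :+ (Pn :* Pj) :* con 0) ≈-refl
    regroup false true  = solve 6 (λ Pn W Pj Qb u v → (Pn :* W :* Pj) :* (con 0 :+ (u :+ v))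
                                   := (Pn :* Pj) :* (u :* W :+ con 0) :+ (Pn :* Pj) :* (W :* v)) ≈-refl
    regroup false false = solve 6 (λ Pn W Pj Qb u v → (Pn :* W :* Pj) :* (con 0 :+ con 0)
                                   := (Pn :* Pj) :* (u :* con 0 :+ con 0) :+ (Pn :* Pj) :* con 0) ≈-refl

    -- The coefficient of x^(j+1) in (z − 1) z^(n−1) y^n x^(n+1), with n + 1 in place of n.
    constTerm : ℕ → ℕ → Carrier
    constTerm n j = if j ≡ᵇ suc n then (z + - 1#) * (z ^ n * y ^ suc n) else 0#

    weight-replicate-0 : ∀ n → w (replicate (suc n) 0) ≈ y ^ n * z ^ n
    weight-replicate-0 n
      rewrite tel-replicate-0 n | uel-replicate-0 n | sumE-replicate-0 n | inv-replicate-0 (suc n)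
      = *-congˡ (≈-trans (*-congˡ (*-identityˡ 1#)) (*-identityʳ _))

    z-correction : ∀ n t j → length t ≡ n →
      (p ^ suc n * p⁻¹ ^ j) * (if noz (0 ∷ t) ≡ᵇ j then w (0 ∷ t) * (y * (zFactor (maxE t ≡ᵇ 0) + - 1#)) else 0#)
        ≈ (if maxE t ≡ᵇ 0 then constTerm n j else 0#)
    z-correction n t j len with maxE t ≡ᵇ 0 | ≡ᵇ-reflects-≡ (maxE t) 0
    ... | false | _ = ≈-trans (*-congˡ (if-≈0 (noz (0 ∷ t) ≡ᵇ j) W*y*0≈0)) (zeroʳ _)
      where
      W*y*0≈0 : w (0 ∷ t) * (y * (1# + - 1#)) ≈ 0#
      W*y*0≈0 = ≈-trans (*-congˡ (≈-trans (*-congˡ (-‿inverseʳ 1#)) (zeroʳ y))) (zeroʳ _)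
    ... | true | ofʸ maxE≡0 rewrite trans (maxE≡0⇒replicate t maxE≡0) (cong (λ l → replicate l 0) len) | noz-replicate-0 n
                     | ≡ᵇ-sym j (suc n)
      with suc n ≡ᵇ j | ≡ᵇ-reflects-≡ (suc n) j
    ...   | false | ofⁿ _    = zeroʳ _
    ...   | true  | ofʸ refl = begin
      (p ^ suc n * p⁻¹ ^ suc n) * (w (replicate (suc n) 0) * (y * (z + - 1#)))
        ≈⟨ *-cong (^-inverse (suc n)) (*-congʳ (weight-replicate-0 n)) ⟩
      1# * ((y ^ n * z ^ n) * (y * (z + - 1#)))
        ≈⟨ *-identityˡ _ ⟩
      (y ^ n * z ^ n) * (y * (z + - 1#))
        ≈⟨ solve 4 (λ Y Z y v → (Y :* Z) :* (y :* v) := v :* (Z :* (y :* Y))) ≈-refl (y ^ n) (z ^ n) y (z + - 1#) ⟩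
      (z + - 1#) * (z ^ n * y ^ suc n) ∎

    ∑-lifts-coeff-regrouped : ∀ t j →
      let e = 0 ∷ t in
      ∑-lifts e (λ s → if noz s ≡ᵇ j then w (0 ∷ s) else 0#)
        ≈ (p ^ length e * p⁻¹ ^ j) * ((y + - 1#) * (if noz e ≡ᵇ j then w e else 0#)
                                      + (if j ≤ᵇ noz e then w e * qbinom R q (noz e) (noz e ∸ j) else 0#))
          + (if maxE e ≡ᵇ 0 then constTerm (length t) j else 0#)
    ∑-lifts-coeff-regrouped t j = begin
      ∑-lifts (0 ∷ t) (λ s → if noz s ≡ᵇ j then w (0 ∷ s) else 0#)
        ≈⟨ ∑-lifts-coeff t j ⟩
      (Pn * W * Pj) * ((if j ≤ᵇ m then qb else 0#) + (if m ≡ᵇ j then D * 1# else 0#))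
        ≈⟨ *-congˡ (+-congˡ (if-cong (m ≡ᵇ j) (≈-trans (*-identityʳ D) (xy-1 y Z)))) ⟩
      (Pn * W * Pj) * ((if j ≤ᵇ m then qb else 0#) + (if m ≡ᵇ j then (y + - 1#) + y * (Z + - 1#) else 0#))
        ≈⟨ regroup (j ≤ᵇ m) (m ≡ᵇ j) Pn W Pj qb (y + - 1#) (y * (Z + - 1#)) ⟩
      (Pn * Pj) * ((y + - 1#) * (if m ≡ᵇ j then W else 0#) + (if j ≤ᵇ m then W * qb else 0#))
        + (Pn * Pj) * (if m ≡ᵇ j then W * (y * (Z + - 1#)) else 0#)
        ≈⟨ +-congˡ (z-correction (length t) t j refl) ⟩
      (Pn * Pj) * ((y + - 1#) * (if m ≡ᵇ j then W else 0#) + (if j ≤ᵇ m then W * qb else 0#))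
        + (if maxE t ≡ᵇ 0 then constTerm (length t) j else 0#) ∎
      where
      m  = noz (0 ∷ t)
      W  = w (0 ∷ t)
      Pn = p ^ suc (length t)
      Pj = p⁻¹ ^ j
      Z  = zFactor (maxE t ≡ᵇ 0)
      D  = y * Z + - 1#
      qb = qbinom R q m (m ∸ j)

    length-F : ∀ n → length (F R y z p q n) ≡ suc n
    length-F n = trans (length-map _ (upTo (suc n))) (length-upTo (suc n))

    coeff-Tq-F : ∀ n j →
      coeff R (Tq R q (F R y z p q n)) j ≈ ∑ (I n) (λ e → if j ≤ᵇ noz e then w e * qbinom R q (noz e) (noz e ∸ j) else 0#)
    coeff-Tq-F n j = begin
      coeff R (Tq R q (F R y z p q n)) j
        ≈⟨ coeff-Tq q (F R y z p q n) j ⟩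
      ∑ (upTo (length (F R y z p q n))) (λ m → if j ≤ᵇ m then coeff R (F R y z p q n) m * qb m else 0#)
        ≡⟨ cong (λ L → ∑ (upTo L) (λ m → if j ≤ᵇ m then coeff R (F R y z p q n) m * qb m else 0#)) (length-F n) ⟩
      ∑ (upTo (suc n)) (λ m → if j ≤ᵇ m then coeff R (F R y z p q n) m * qb m else 0#)
        ≈⟨ ∑-cong (upTo (suc n)) expand ⟩
      ∑ (upTo (suc n)) (λ m → ∑ (I n) (λ e → if noz e ≡ᵇ m then h e m else 0#))
        ≈⟨ ∑-comm (upTo (suc n)) (I n) (λ m e → if noz e ≡ᵇ m then h e m else 0#) ⟩
      ∑ (I n) (λ e → ∑ (upTo (suc n)) (λ m → if noz e ≡ᵇ m then h e m else 0#))
        ≈⟨ ∑-congᴬ (I-length n) (λ {e} len → ∑-upTo-δ (h e) (s≤s (subst (noz e ≤_) len (noz≤length e)))) ⟩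
      ∑ (I n) (λ e → h e (noz e)) ∎
      where
      qb : ℕ → Carrier
      qb m = qbinom R q m (m ∸ j)
      h : List ℕ → ℕ → Carrier
      h e m = if j ≤ᵇ m then w e * qb m else 0#
      expand : ∀ m → (if j ≤ᵇ m then coeff R (F R y z p q n) m * qb m else 0#)
                     ≈ ∑ (I n) (λ e → if noz e ≡ᵇ m then h e m else 0#)
      expand m with j ≤ᵇ m
      ... | true  = begin
        coeff R (F R y z p q n) m * qb m
          ≈⟨ *-congʳ (coeff-F y z p q n m) ⟩
        ∑ (I n) (λ e → if noz e ≡ᵇ m then w e else 0#) * qb m
          ≈⟨ *-distribʳ-∑ (I n) (qb m) _ ⟩
        ∑ (I n) (λ e → (if noz e ≡ᵇ m then w e else 0#) * qb m)
          ≈⟨ ∑-cong (I n) (λ e → if-*ʳ (noz e ≡ᵇ m) (w e) (qb m)) ⟩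
        ∑ (I n) (λ e → if noz e ≡ᵇ m then w e * qb m else 0#) ∎
      ... | false = ≈-sym (≈-trans (∑-cong (I n) (λ e → if-≈0 (noz e ≡ᵇ m) ≈-refl)) (∑-zero (I n)))

    coeff-RHS-zero : ∀ n → coeff R (RHS R y z p q p⁻¹ n) 0 ≈ 0#
    coeff-RHS-zero n = begin
      coeff R (RHS R y z p q p⁻¹ n) 0 ≈⟨ coeff-⊕ (mono R zn (suc n)) (scale R (p ^ n) G) 0 ⟩
      0# + coeff R (scale R (p ^ n) G) 0 ≈⟨ +-identityˡ _ ⟩
      coeff R (scale R (p ^ n) G) 0      ≈⟨ coeff-scale (p ^ n) G 0 ⟩
      p ^ n * 0#                         ≈⟨ zeroʳ _ ⟩
      0#                                 ∎
      where
      zn = (z + - 1#) * (z ^ (n ∸ 1) * y ^ n)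
      Fn = F R y z p q n
      G  = mulX R (_⊕_ R (scale R (y + - 1#) (substDiv R p⁻¹ Fn)) (substDiv R p⁻¹ (Tq R q Fn)))

    coeff-RHS-suc : ∀ n j → coeff R (RHS R y z p q p⁻¹ (suc n)) (suc j)
      ≈ constTerm n j + p ^ suc n * ((y + - 1#) * (coeff R (F R y z p q (suc n)) j * p⁻¹ ^ j)
                                     + coeff R (Tq R q (F R y z p q (suc n))) j * p⁻¹ ^ j)
    coeff-RHS-suc n j = begin
      coeff R (RHS R y z p q p⁻¹ (suc n)) (suc j)
        ≈⟨ coeff-⊕ (mono R zn (suc (suc n))) (scale R (p ^ suc n) (mulX R (_⊕_ R U V))) (suc j) ⟩
      coeff R (mono R zn (suc n)) j + coeff R (scale R (p ^ suc n) (mulX R (_⊕_ R U V))) (suc j)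
        ≈⟨ +-cong (reflexive (coeff-mono zn (suc n) j)) (coeff-scale (p ^ suc n) (mulX R (_⊕_ R U V)) (suc j)) ⟩
      constTerm n j + p ^ suc n * coeff R (_⊕_ R U V) j
        ≈⟨ +-congˡ (*-congˡ (coeff-⊕ U V j)) ⟩
      constTerm n j + p ^ suc n * (coeff R U j + coeff R V j)
        ≈⟨ +-congˡ (*-congˡ (+-cong
             (≈-trans (coeff-scale (y + - 1#) (substDiv R p⁻¹ Fn) j) (*-congˡ (coeff-substDiv p⁻¹ Fn j)))
             (coeff-substDiv p⁻¹ (Tq R q Fn) j))) ⟩
      constTerm n j + p ^ suc n * ((y + - 1#) * (coeff R Fn j * p⁻¹ ^ j) + coeff R (Tq R q Fn) j * p⁻¹ ^ j) ∎
      where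
      zn = (z + - 1#) * (z ^ n * y ^ suc n)
      Fn = F R y z p q (suc n)
      U  = scale R (y + - 1#) (substDiv R p⁻¹ Fn)
      V  = substDiv R p⁻¹ (Tq R q Fn)

    coeff-F-suc-suc : ∀ n j → coeff R (F R y z p q (suc (suc n))) (suc j)
      ≈ (p ^ suc n * p⁻¹ ^ j) * ((y + - 1#) * coeff R (F R y z p q (suc n)) j + coeff R (Tq R q (F R y z p q (suc n))) j)
        + constTerm n j
    coeff-F-suc-suc n j = begin
      coeff R (F R y z p q (suc N)) (suc j)
        ≈⟨ coeff-F y z p q (suc N) (suc j) ⟩
      ∑ (I (suc N)) (λ e → if noz e ≡ᵇ suc j then w e else 0#)
        ≈⟨ ∑-I-lifts N (λ e → if noz e ≡ᵇ suc j then w e else 0#) ⟩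
      ∑ (I N) (λ e → ∑-lifts e (λ s → if noz s ≡ᵇ j then w (0 ∷ s) else 0#))
        ≈⟨ ∑-congᴬ (I-suc-shape n) (λ { (t , refl , refl) → ∑-lifts-coeff-regrouped t j }) ⟩
      ∑ (I N) (λ e → Pnj * (fTerm e + tqTerm e) + (if maxE e ≡ᵇ 0 then constTerm n j else 0#))
        ≈⟨ ∑-+ (I N) (λ e → Pnj * (fTerm e + tqTerm e)) (λ e → if maxE e ≡ᵇ 0 then constTerm n j else 0#) ⟩
      ∑ (I N) (λ e → Pnj * (fTerm e + tqTerm e)) + ∑ (I N) (λ e → if maxE e ≡ᵇ 0 then constTerm n j else 0#)
        ≈⟨ +-cong (≈-sym (*-distribˡ-∑ (I N) Pnj (λ e → fTerm e + tqTerm e))) (∑-I-maxE≡0 N (constTerm n j)) ⟩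
      Pnj * ∑ (I N) (λ e → fTerm e + tqTerm e) + constTerm n j
        ≈⟨ +-congʳ (*-congˡ (∑-+ (I N) fTerm tqTerm)) ⟩
      Pnj * (∑ (I N) fTerm + ∑ (I N) tqTerm) + constTerm n j
        ≈⟨ +-congʳ (*-congˡ (+-cong
             (≈-trans (≈-sym (*-distribˡ-∑ (I N) (y + - 1#) _)) (*-congˡ (≈-sym (coeff-F y z p q N j))))
             (≈-sym (coeff-Tq-F N j)))) ⟩
      Pnj * ((y + - 1#) * coeff R (F R y z p q N) j + coeff R (Tq R q (F R y z p q N)) j) + constTerm n j ∎
      where
      N = suc n
      Pnj = p ^ N * p⁻¹ ^ j
      fTerm tqTerm : List ℕ → Carrier
      fTerm e = (y + - 1#) * (if noz e ≡ᵇ j then w e else 0#)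
      tqTerm e = if j ≤ᵇ noz e then w e * qbinom R q (noz e) (noz e ∸ j) else 0#

    F-recurrence : ∀ n → 1 ≤ n → _≈P_ R (F R y z p q (suc n)) (RHS R y z p q p⁻¹ n)
    F-recurrence (suc n) _ zero = begin
      coeff R (F R y z p q (suc (suc n))) 0
        ≈⟨ coeff-F y z p q (suc (suc n)) 0 ⟩
      ∑ (I (suc (suc n))) (λ e → if noz e ≡ᵇ 0 then w e else 0#)
        ≈⟨ ∑-congᴬ (I-suc-shape (suc n)) (λ { (t , refl , _) → ≈-refl }) ⟩   -- noz (0 ∷ t) is a successor
      ∑ (I (suc (suc n))) (λ _ → 0#)
        ≈⟨ ∑-zero (I (suc (suc n))) ⟩
      0#
        ≈⟨ coeff-RHS-zero (suc n) ⟨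
      coeff R (RHS R y z p q p⁻¹ (suc n)) 0 ∎
    F-recurrence (suc n) _ (suc j) = begin
      coeff R (F R y z p q (suc (suc n))) (suc j)
        ≈⟨ coeff-F-suc-suc n j ⟩
      (p ^ suc n * p⁻¹ ^ j) * ((y + - 1#) * Fj + Tj) + constTerm n j
        ≈⟨ solve 6 (λ Pn Pj u F T c → (Pn :* Pj) :* (u :* F :+ T) :+ c := c :+ Pn :* (u :* (F :* Pj) :+ T :* Pj))
                   ≈-refl (p ^ suc n) (p⁻¹ ^ j) (y + - 1#) Fj Tj (constTerm n j) ⟩
      constTerm n j + p ^ suc n * ((y + - 1#) * (Fj * p⁻¹ ^ j) + Tj * p⁻¹ ^ j)
        ≈⟨ coeff-RHS-suc n j ⟨
      coeff R (RHS R y z p q p⁻¹ (suc n)) (suc j) ∎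
      where
      Fj = coeff R (F R y z p q (suc n)) j
      Tj = coeff R (Tq R q (F R y z p q (suc n))) j

  F-one : ∀ y z p q → _≈P_ R (F R y z p q 1) (0# ∷ 1# ∷ [])
  F-one y z p q zero          = +-identityʳ 0#
  F-one y z p q (suc zero)    = ≈-trans (+-identityʳ _) (≈-trans (*-identityˡ _) (≈-trans (*-identityˡ _) (*-identityˡ 1#)))
  F-one y z p q (suc (suc k)) = ≈-refl

mainTheorem1 : ∀ {c ℓ} (R : CommutativeRing c ℓ) →
    let open CommutativeRing R in
    (y z p q pinv : Carrier) → p * pinv ≈ 1# →
    (_≈P_ R (F R y z p q 1) (0# ∷ 1# ∷ []))
    × (∀ (n : ℕ) → 1 ≤ n → _≈P_ R (F R y z p q (suc n)) (RHS R y z p q pinv n))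
mainTheorem1 R y z p q pinv p*pinv≈1 = F-one R y z p q , Recurrence.F-recurrence R y z p q pinv p*pinv≈1
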